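{- Let $G$ be an $n$-vertex graph with a simplicial elimination ordering $<$. Let $J$ be the orientation of $G$ obtained by orienting each edge $uv$ with $u < v$ from $v$ to $u$. Then $G$ is $d^{+}_J$-saturable.
   Context: Graphs are finite and simple. A simplicial elimination ordering is a vertex ordering $<$ such that, writing the vertices as $v_1, \ldots, v_n$ in order, for each $i$ the neighborhood of $v_i$ in $G - \{v_1, \ldots, v_{i-1}\}$ is a clique. $d^{+}_J(v)$ is the outdegree of $v$ in $J$. A list assignment $\ell$ on $G$ assigns to each vertex $v$ a set of colors $\ell(v)$. A proper partial edge coloring of $G$ is $\ell$-saturating if for every vertex $v$ and every color $c \in \ell(v)$, some edge incident to $v$ receives color $c$. For $f: V(G) \to \mathbb{Z}_{\ge 0}$, $G$ is $f$-saturable if for every list assignment $\ell$ with $|\ell(v)| \leq f(v)$ for all $v$, $G$ has an $\ell$-saturating proper partial edge coloring. -}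

module Defs where

open import Data.Nat using (ℕ; _<_; _≤_; _<?_)
open import Data.Bool using (Bool; true; false; _∧_)
open import Data.Fin using (Fin)
open import Data.List using (List; length; filter; allFin)
open import Data.List.Membership.Propositional using (_∈_)
open import Data.List.Relation.Unary.Unique.Propositional using (Unique)
open import Data.Maybe using (Maybe; just)
open import Data.Product using (∃-syntax; _×_)
open import Relation.Binary.PropositionalEquality using (_≡_; _≢_)
open import Relation.Nullary using (Dec; yes; no)
open import Function.Definitions using (Injective)
import Data.Empty
import Data.Product

record Graph (n : ℕ) : Set where
  field
    adj   : Fin n → Fin n → Bool
    sym   : ∀ u v → adj u v ≡ adj v u
    irref : ∀ v → adj v v ≡ false
open Graph public

Adj : ∀ {n} → Graph n → Fin n → Fin n → Set
Adj G u v = adj G u v ≡ true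

record VertexOrder (n : ℕ) : Set where
  field
    rank  : Fin n → ℕ
    rank-inj : Injective _≡_ _≡_ rank
open VertexOrder public

Before : ∀ {n} → VertexOrder n → Fin n → Fin n → Set
Before o u v = rank o u < rank o v

IsSimplicial : ∀ {n} → Graph n → VertexOrder n → Set
IsSimplicial G o = ∀ v u w → Adj G v u → Adj G v w →
  Before o v u → Before o v w → u ≢ w → Adj G u w

-- Outdegree of v in the orientation J, where each edge uv with u < v is
-- oriented from v to u: the number of neighbours u of v with u < v.
outdeg : ∀ {n} → Graph n → VertexOrder n → Fin n → ℕ
outdeg {n} G o v = length (filter (λ u → dec (adj G v u) (rank o u <? rank o v)) (allFin n))
  where
  dec : ∀ (b : Bool) {P : Set} → Dec P → Dec ((b ≡ true) × P)
  dec true (yes p) = yes (Data.Product._,_ _≡_.refl p)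
  dec true (no ¬p) = no (λ x → ¬p (Data.Product.proj₂ x))
  dec false _ = no (λ x → f (Data.Product.proj₁ x))
    where f : false ≡ true → Data.Empty.⊥
          f ()

-- Colours are natural numbers. A list assignment gives each vertex a finite
-- set of colours (a duplicate-free list).
ListAssignment : ℕ → Set
ListAssignment n = Fin n → List ℕ

-- A partial edge colouring: col u v = just c means edge uv receives colour c;
-- nothing means uncoloured (or not an edge).
PartialEdgeColouring : ℕ → Set
PartialEdgeColouring n = Fin n → Fin n → Maybe ℕ

IsProperPartialEdgeColouring : ∀ {n} → Graph n → PartialEdgeColouring n → Set
IsProperPartialEdgeColouring G col =
  (∀ u v → col u v ≡ col v u) ×
  (∀ u v c → col u v ≡ just c → Adj G u v) ×
  (∀ u v w c → col u v ≡ just c → col u w ≡ just c → v ≡ w)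

IsSaturating : ∀ {n} → ListAssignment n → PartialEdgeColouring n → Set
IsSaturating ℓ col = ∀ v c → c ∈ ℓ v → ∃[ u ] (col v u ≡ just c)

Saturable : ∀ {n} → Graph n → (Fin n → ℕ) → Set
Saturable {n} G f = (ℓ : ListAssignment n) →
  (∀ v → Unique (ℓ v)) → (∀ v → length (ℓ v) ≤ f v) →
  ∃[ col ] (IsProperPartialEdgeColouring G col × IsSaturating ℓ col)

-- Eliminate the vertices in the given order.  The first vertex p of what is
-- left has outdegree 0, hence an empty list, and since the order is
-- simplicial its later neighbours K form a clique.  Let the vertices of K, in
-- increasing order, greedily pick distinct colours from their lists.  A
-- vertex w of K that finds every colour of its list already picked has a list
-- no longer than the number of earlier members of K, all of which are
-- out-neighbours of w in G - p; every other w of K loses its picked colour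
-- and p as an out-neighbour.  So the reduced lists fit G - p, induction
-- saturates them, and colouring pw with the colour picked by w, whenever
-- that colour is still missing at w, saturates the picked colours too.
module Submission where

open import Defs hiding (sym)
open import Data.Bool.Base using (true)
import Data.Bool.Properties as Bool
open import Data.Fin.Base using (Fin; zero; suc)
open import Data.Fin.Properties using (any?) renaming (_≟_ to _≟ᶠ_)
open import Data.List.Base using (List; []; _∷_; length; filter; allFin; find; mapMaybe)
open import Data.List.Properties
  using (length-filter; filter-notAll; filter-none; length-mapMaybe; length-removeAt′)
open import Data.List.Membership.Propositional using (_∈_; _∉_)
open import Data.List.Membership.Propositional.Properties using (∈-filter⁺; ∈-filter⁻; ∈-allFin)
open import Data.List.Relation.Binary.Subset.Propositional using (_⊆_)
import Data.List.Relation.Binary.Sublist.Propositional as Sublist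
import Data.List.Relation.Binary.Sublist.Propositional.Properties as Sublist
open import Data.List.Relation.Unary.All using (All; []; _∷_)
import Data.List.Relation.Unary.All as All
open import Data.List.Relation.Unary.Any using (here; there; _─_)
import Data.List.Relation.Unary.Any as Any
open import Data.List.Relation.Unary.Unique.Propositional using (Unique; _∷_)
open import Data.List.Relation.Unary.Unique.Propositional.Properties using (allFin⁺)
import Data.List.Relation.Unary.Unique.Propositional.Properties as Unique
open import Data.Maybe.Base using (Maybe; just; nothing)
import Data.Maybe.Properties as Maybe
open import Data.Nat.Base using (ℕ; zero; suc; _+_; _≤_; _<_; _⊔_; z≤n; s≤s)
open import Data.Nat.Properties
open import Data.Product using (∃-syntax; _×_; _,_; proj₁; proj₂)
open import Data.Sum.Base using (_⊎_; inj₁; inj₂)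
open import Function.Base using (_∘_; case_of_)
open import Level using (0ℓ)
open import Relation.Binary.Definitions using (tri<; tri≈; tri>)
open import Relation.Binary.PropositionalEquality
  using (_≡_; _≢_; refl; sym; trans; cong; subst)
open import Relation.Nullary using (Dec; yes; no; ¬_; ¬?; _×-dec_; contradiction)
open import Relation.Nullary.Decidable using (decidable-stable)
open import Relation.Unary using (Pred; Decidable; ∁)

private
  variable
    A B : Set

∈-─ : ∀ {x y : A} {ys : List A} (x∈ys : x ∈ ys) → y ∈ ys → y ≢ x → y ∈ (ys ─ x∈ys)
∈-─ (here refl) (here refl) y≢x = contradiction refl y≢x
∈-─ (here refl) (there y∈ys) _  = y∈ys
∈-─ (there _)   (here y≡z)   _  = here y≡z
∈-─ (there x∈ys) (there y∈ys) y≢x = there (∈-─ x∈ys y∈ys y≢x)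

unique⊆⇒length≤ : ∀ {xs ys : List A} → Unique xs → xs ⊆ ys → length xs ≤ length ys
unique⊆⇒length≤ {xs = []}     _               _     = z≤n
unique⊆⇒length≤ {xs = x ∷ xs} {ys} (x∉xs ∷ xs!) xs⊆ys = begin
  suc (length xs)          ≤⟨ s≤s (unique⊆⇒length≤ xs! xs⊆ys─x) ⟩
  suc (length (ys ─ x∈ys)) ≡⟨ sym (length-removeAt′ ys _) ⟩
  length ys                ∎
  where
  open ≤-Reasoning
  x∈ys : x ∈ ys
  x∈ys = xs⊆ys (here refl)
  xs⊆ys─x : xs ⊆ (ys ─ x∈ys)
  xs⊆ys─x y∈xs = ∈-─ x∈ys (xs⊆ys (there y∈xs)) (λ { refl → All.lookup x∉xs y∈xs refl })

∉-length≤0 : ∀ {x : A} {xs} → length xs ≤ 0 → x ∉ xs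
∉-length≤0 {xs = _ ∷ _} ()

∈-mapMaybe⁺ : ∀ {f : A → Maybe B} {x y xs} → x ∈ xs → f x ≡ just y → y ∈ mapMaybe f xs
∈-mapMaybe⁺ {f = f} {xs = z ∷ zs} (here refl) fx≡y with f z
∈-mapMaybe⁺ (here refl) refl | just _ = here refl
∈-mapMaybe⁺ {f = f} {xs = z ∷ zs} (there x∈zs) fx≡y with f z
... | just _  = there (∈-mapMaybe⁺ x∈zs fx≡y)
... | nothing = ∈-mapMaybe⁺ x∈zs fx≡y

length-filter-mono : ∀ {P Q : Pred A 0ℓ} (P? : Decidable P) (Q? : Decidable Q) →
  (∀ {x} → P x → Q x) → ∀ xs → length (filter P? xs) ≤ length (filter Q? xs)
length-filter-mono P? Q? P⇒Q xs =
  Sublist.length-mono-≤ (Sublist.filter⁺ P? Q? (λ { refl → P⇒Q }) (Sublist.⊆-refl {x = xs}))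

module _ {P : Pred A 0ℓ} (P? : Decidable P) where

  find-just : ∀ {x} xs → find P? xs ≡ just x → x ∈ xs × P x
  find-just (y ∷ ys) eq with P? y
  find-just (y ∷ ys) refl | yes py = here refl , py
  ... | no _ = let x∈ys , px = find-just ys eq in there x∈ys , px

  find-nothing : ∀ xs → find P? xs ≡ nothing → All (∁ P) xs
  find-nothing []       _  = []
  find-nothing (y ∷ ys) eq with P? y
  find-nothing (y ∷ ys) () | yes _
  ... | no ¬py = ¬py ∷ find-nothing ys eq

bounded : ∀ {n} (f : Fin n → ℕ) → ∃[ b ] (∀ i → f i < b)
bounded {zero}  f = 0 , λ ()
bounded {suc n} f with bounded (f ∘ suc)
... | b , f∘suc<b = suc (f zero) ⊔ b , bound
  where
  bound : ∀ i → f i < suc (f zero) ⊔ b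
  bound zero    = m≤m⊔n (suc (f zero)) b
  bound (suc i) = <-≤-trans (f∘suc<b i) (m≤n⊔m (suc (f zero)) b)

-- Stage q records the picks made by
-- the vertices of rank below q, which makes the recursion structural.
module Greedy {n} (o : VertexOrder n) {K : Pred (Fin n) 0ℓ} (K? : Decidable K)
              (ℓ : ListAssignment n) where

  Taken : (Fin n → Maybe ℕ) → ℕ → Set
  Taken picks c = ∃[ u ] picks u ≡ just c

  taken? : ∀ picks c → Dec (Taken picks c)
  taken? picks c = any? (λ u → Maybe.≡-dec _≟_ (picks u) (just c))

  choose : (Fin n → Maybe ℕ) → Fin n → Maybe ℕ
  choose picks w with K? w
  ... | yes _ = find (¬? ∘ taken? picks) (ℓ w)
  ... | no _  = nothing

  stage : ℕ → Fin n → Maybe ℕ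
  stage zero    _ = nothing
  stage (suc q) w with rank o w ≟ q
  ... | yes _ = choose (stage q) w
  ... | no _  = stage q w

  pick : Fin n → Maybe ℕ
  pick w = choose (stage (rank o w)) w

  stage-unset : ∀ {q w} → q ≤ rank o w → stage q w ≡ nothing
  stage-unset {zero}  _ = refl
  stage-unset {suc q} {w} q<rw with rank o w ≟ q
  ... | yes refl = contradiction q<rw (n≮n _)
  ... | no _     = stage-unset (<⇒≤ q<rw)

  stage-settled : ∀ {q w} → rank o w < q → stage q w ≡ pick w
  stage-settled {suc q} {w} rw<1+q with rank o w ≟ q
  ... | yes refl = refl
  ... | no rw≢q  = stage-settled (≤∧≢⇒< (≤-pred rw<1+q) rw≢q)

  choose-just : ∀ {picks w c} → choose picks w ≡ just c → K w × c ∈ ℓ w × ¬ Taken picks c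
  choose-just {picks} {w} eq with K? w
  ... | yes kw = kw , find-just _ (ℓ w) eq
  choose-just () | no _

  choose-nothing : ∀ {picks w c} → K w → choose picks w ≡ nothing → c ∈ ℓ w → Taken picks c
  choose-nothing {picks} {w} kw eq c∈ℓw with K? w
  ... | yes _ = decidable-stable (taken? picks _) (All.lookup (find-nothing _ (ℓ w) eq) c∈ℓw)
  ... | no ¬kw = contradiction kw ¬kw

  pick-just : ∀ {w c} → pick w ≡ just c → K w × c ∈ ℓ w
  pick-just eq = let kw , c∈ℓw , _ = choose-just eq in kw , c∈ℓw

  pick-untaken : ∀ {u w c} → pick w ≡ just c → rank o u < rank o w → pick u ≢ just c
  pick-untaken pw ru<rw pu = proj₂ (proj₂ (choose-just pw)) (_ , trans (stage-settled ru<rw) pu)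

  pick-injective : ∀ {w w' c} → pick w ≡ just c → pick w' ≡ just c → w ≡ w'
  pick-injective {w} {w'} pw pw' with <-cmp (rank o w) (rank o w')
  ... | tri< rw<rw' _ _ = contradiction pw (pick-untaken pw' rw<rw')
  ... | tri≈ _ rw≡rw' _ = rank-inj o rw≡rw'
  ... | tri> _ _ rw'<rw = contradiction pw' (pick-untaken pw rw'<rw)

  pick-nothing : ∀ {w c} → K w → pick w ≡ nothing → c ∈ ℓ w →
                 ∃[ u ] rank o u < rank o w × pick u ≡ just c
  pick-nothing {w} kw eq c∈ℓw with choose-nothing kw eq c∈ℓw
  ... | u , su≡c with rank o u <? rank o w
  ...   | yes ru<rw = u , ru<rw , trans (sym (stage-settled ru<rw)) su≡c
  ...   | no ru≮rw  with () ← trans (sym (stage-unset (≮⇒≥ ru≮rw))) su≡c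

module _ {n} (G : Graph n) where

  Adj-sym : ∀ {u v} → Adj G u v → Adj G v u
  Adj-sym {u} {v} = trans (Graph.sym G v u)

  module StarExtension
    {col : PartialEdgeColouring n} (col-proper : IsProperPartialEdgeColouring G col)
    {p : Fin n} (p-uncoloured : ∀ v → col p v ≡ nothing)
    {star : Fin n → Maybe ℕ}
    (star-adj : ∀ {w c} → star w ≡ just c → Adj G p w)
    (star-injective : ∀ {w w' c} → star w ≡ just c → star w' ≡ just c → w ≡ w')
    (star-fresh : ∀ {w c u} → star w ≡ just c → col w u ≢ just c)
    where

    private
      col-sym : ∀ u v → col u v ≡ col v u
      col-sym = proj₁ col-proper

      col-adj : ∀ u v c → col u v ≡ just c → Adj G u v
      col-adj = proj₁ (proj₂ col-proper)

      col-injective : ∀ u v w c → col u v ≡ just c → col u w ≡ just c → v ≡ w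
      col-injective = proj₂ (proj₂ col-proper)

    extend : PartialEdgeColouring n
    extend u v with u ≟ᶠ p | v ≟ᶠ p
    ... | yes _ | _     = star v
    ... | no _  | yes _ = star u
    ... | no _  | no _  = col u v

    extend-at-p : ∀ {v} → v ≢ p → extend v p ≡ star v
    extend-at-p {v} v≢p with v ≟ᶠ p | p ≟ᶠ p
    ... | yes v≡p | _     = contradiction v≡p v≢p
    ... | no _    | yes _ = refl
    ... | no _    | no p≢p = contradiction refl p≢p

    extend-⊇ : ∀ {v u c} → col v u ≡ just c → extend v u ≡ just c
    extend-⊇ {v} {u} e with v ≟ᶠ p | u ≟ᶠ p
    ... | yes refl | _        with () ← trans (sym e) (p-uncoloured u)
    ... | no _     | yes refl with () ← trans (sym e) (trans (col-sym v p) (p-uncoloured v))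
    ... | no _     | no _     = e

    extend-cases : ∀ {u v c} → extend u v ≡ just c →
                   col u v ≡ just c ⊎ u ≡ p ⊎ star u ≡ just c
    extend-cases {u} {v} e with u ≟ᶠ p | v ≟ᶠ p
    ... | yes u≡p | _     = inj₂ (inj₁ u≡p)
    ... | no _    | yes _ = inj₂ (inj₂ e)
    ... | no _    | no _  = inj₁ e

    extend-proper : IsProperPartialEdgeColouring G extend
    extend-proper = extend-sym , extend-adj , extend-injective
      where
      extend-sym : ∀ u v → extend u v ≡ extend v u
      extend-sym u v with u ≟ᶠ p | v ≟ᶠ p
      ... | yes refl | yes refl = refl
      ... | yes refl | no _     = refl
      ... | no _     | yes refl = refl
      ... | no _     | no _     = col-sym u v

      extend-adj : ∀ u v c → extend u v ≡ just c → Adj G u v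
      extend-adj u v c e with u ≟ᶠ p | v ≟ᶠ p
      ... | yes refl | _        = star-adj e
      ... | no _     | yes refl = Adj-sym (star-adj e)
      ... | no _     | no _     = col-adj u v c e

      extend-injective : ∀ u v w c → extend u v ≡ just c → extend u w ≡ just c → v ≡ w
      extend-injective u v w c e e' with u ≟ᶠ p
      ... | yes refl = star-injective e e'
      ... | no _ with v ≟ᶠ p | w ≟ᶠ p
      ...   | yes refl | yes refl = refl
      ...   | yes refl | no _     = contradiction e' (star-fresh e)
      ...   | no _     | yes refl = contradiction e (star-fresh e')
      ...   | no _     | no _     = col-injective u v w c e e'

  module _ (o : VertexOrder n) where

    private
      r : Fin n → ℕ
      r = rank o

    Back : ℕ → Fin n → Pred (Fin n) 0ℓ
    Back t v u = Adj G v u × t ≤ r u × r u < r v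

    back? : ∀ t v → Decidable (Back t v)
    back? t v u = (adj G v u Bool.≟ true) ×-dec (t ≤? r u) ×-dec (r u <? r v)

    backs : ℕ → Fin n → List (Fin n)
    backs t v = filter (back? t v) (allFin n)

    deg : ℕ → Fin n → ℕ
    deg t v = length (backs t v)

    deg-mono : ∀ {t t' v} → (∀ {u} → Back t v u → Back t' v u) → deg t v ≤ deg t' v
    deg-mono {t} {t'} {v} back⇒back = length-filter-mono (back? t v) (back? t' v) back⇒back (allFin n)

    backless⇒∉ : ∀ {t v c} {cs : List ℕ} → (∀ u → ¬ Back t v u) → length cs ≤ deg t v → c ∉ cs
    backless⇒∉ {t} {v} ¬back cs-short = ∉-length≤0 (subst (_ ≤_) deg≡0 cs-short)
      where
      deg≡0 : deg t v ≡ 0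
      deg≡0 = cong length (filter-none (back? t v) {xs = allFin n} (All.tabulate λ {u} _ → ¬back u))

    outdeg≤deg : ∀ v → outdeg G o v ≤ deg 0 v
    outdeg≤deg v = length-filter-mono _ (back? 0 v) (λ (a , lt) → a , z≤n , lt) (allFin n)

    SaturableFrom : ℕ → Set
    SaturableFrom t = (ℓ : ListAssignment n) → (∀ v → Unique (ℓ v)) →
      (∀ v → length (ℓ v) ≤ deg t v) →
      ∃[ col ] (IsProperPartialEdgeColouring G col × IsSaturating ℓ col ×
                (∀ {u v c} → col u v ≡ just c → t ≤ r u))

    module Eliminate
      (simplicial : IsSimplicial G o) {t p} (rp≡t : r p ≡ t) (IH : SaturableFrom (suc t))
      (ℓ : ListAssignment n) (ℓ-unique : ∀ v → Unique (ℓ v))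
      (ℓ-short : ∀ v → length (ℓ v) ≤ deg t v)
      where

      K : Pred (Fin n) 0ℓ
      K w = Adj G p w × r p < r w

      K? : Decidable K
      K? w = (adj G p w Bool.≟ true) ×-dec (r p <? r w)

      open Greedy o K? ℓ

      K-clique : ∀ {u w} → K u → K w → u ≢ w → Adj G u w
      K-clique (apu , pu) (apw , pw) = simplicial p _ _ apu apw pu pw

      back-step : ∀ {w u} → Back t w u → Back (suc t) w u ⊎ (u ≡ p × K w)
      back-step {w} {u} (awu , t≤ru , ru<rw) with u ≟ᶠ p
      ... | yes refl = inj₂ (refl , Adj-sym awu , ru<rw)
      ... | no u≢p   = inj₁ (awu , ≤∧≢⇒< t≤ru t≢ru , ru<rw)
        where
        t≢ru : t ≢ r u
        t≢ru t≡ru = u≢p (rank-inj o (trans (sym t≡ru) (sym rp≡t)))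

      deg-step : ∀ w → deg t w ≤ suc (deg (suc t) w)
      deg-step w = unique⊆⇒length≤ (Unique.filter⁺ (back? t w) (allFin⁺ n)) backs⊆
        where
        backs⊆ : backs t w ⊆ p ∷ backs (suc t) w
        backs⊆ u∈ with back-step (proj₂ (∈-filter⁻ (back? t w) {xs = allFin n} u∈))
        ... | inj₁ back      = there (∈-filter⁺ (back? (suc t) w) (∈-allFin _) back)
        ... | inj₂ (refl , _) = here refl

      deg-step-¬K : ∀ {w} → ¬ K w → deg t w ≤ deg (suc t) w
      deg-step-¬K ¬kw = deg-mono λ back → case back-step back of λ
        { (inj₁ back')      → back'
        ; (inj₂ (_ , kw)) → contradiction kw ¬kw }

      p-backless : ∀ u → ¬ Back t p u
      p-backless u (_ , t≤ru , ru<rp) = <-irrefl refl (≤-<-trans t≤ru (subst (r u <_) rp≡t ru<rp))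

      unpicked-short : ∀ {w} → K w → pick w ≡ nothing → length (ℓ w) ≤ deg (suc t) w
      unpicked-short {w} kw unpicked = begin
        length (ℓ w)                              ≤⟨ unique⊆⇒length≤ (ℓ-unique w) ℓw⊆ ⟩
        length (mapMaybe pick (backs (suc t) w))  ≤⟨ length-mapMaybe pick (backs (suc t) w) ⟩
        deg (suc t) w                             ∎
        where
        open ≤-Reasoning
        ℓw⊆ : ℓ w ⊆ mapMaybe pick (backs (suc t) w)
        ℓw⊆ c∈ℓw with pick-nothing kw unpicked c∈ℓw
        ... | u , ru<rw , picked with pick-just picked
        ...   | ku@(_ , pu) , _ = ∈-mapMaybe⁺ (∈-filter⁺ (back? (suc t) w) (∈-allFin u) back) picked
          where
          back : Back (suc t) w u
          back = K-clique kw ku (λ { refl → <-irrefl refl ru<rw }) , subst (_< r u) rp≡t pu , ru<rw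

      ℓ′ : ListAssignment n
      ℓ′ w = filter (λ c → ¬? (Maybe.≡-dec _≟_ (pick w) (just c))) (ℓ w)

      ℓ′-short : ∀ w → length (ℓ′ w) ≤ deg (suc t) w
      ℓ′-short w = short (pick w) refl
        where
        short : ∀ m → pick w ≡ m → length (ℓ′ w) ≤ deg (suc t) w
        short (just c) picked = ≤-pred (begin-strict
          length (ℓ′ w)       <⟨ filter-notAll _ (ℓ w) (Any.map (λ { refl ¬pc → ¬pc picked }) c∈ℓw) ⟩
          length (ℓ w)        ≤⟨ ℓ-short w ⟩
          deg t w             ≤⟨ deg-step w ⟩
          suc (deg (suc t) w) ∎)
          where
          open ≤-Reasoning
          c∈ℓw = proj₂ (pick-just picked)
        short nothing unpicked = ≤-trans (length-filter _ (ℓ w)) (case K? w of λ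
          { (yes kw) → unpicked-short kw unpicked
          ; (no ¬kw) → ≤-trans (ℓ-short w) (deg-step-¬K ¬kw) })

      rest-colouring : ∃[ col ] (IsProperPartialEdgeColouring G col × IsSaturating ℓ′ col ×
                                 (∀ {u v c} → col u v ≡ just c → suc t ≤ r u))
      rest-colouring = IH ℓ′ (λ w → Unique.filter⁺ _ (ℓ-unique w)) ℓ′-short

      col′ : PartialEdgeColouring n
      col′ = proj₁ rest-colouring

      col′-saturating : IsSaturating ℓ′ col′
      col′-saturating = proj₁ (proj₂ (proj₂ rest-colouring))

      col′-above : ∀ {u v c} → col′ u v ≡ just c → suc t ≤ r u
      col′-above = proj₂ (proj₂ (proj₂ rest-colouring))

      p-uncoloured : ∀ v → col′ p v ≡ nothing
      p-uncoloured v with col′ p v in e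
      ... | nothing = refl
      ... | just _  = contradiction (subst (suc t ≤_) rp≡t (col′-above e)) (n≮n t)

      Present : Fin n → ℕ → Set
      Present w c = ∃[ u ] col′ w u ≡ just c

      present? : ∀ w c → Dec (Present w c)
      present? w c = any? λ u → Maybe.≡-dec _≟_ (col′ w u) (just c)

      star : Fin n → Maybe ℕ
      star w with pick w
      ... | nothing = nothing
      ... | just c with present? w c
      ...   | yes _ = nothing
      ...   | no _  = just c

      star-just : ∀ {w c} → star w ≡ just c → pick w ≡ just c × ¬ Present w c
      star-just {w} e with pick w
      ... | just c with present? w c
      star-just {w} refl | just c | no absent = refl , absent

      star-picked : ∀ {w c} → pick w ≡ just c → ¬ Present w c → star w ≡ just c
      star-picked {w} {c} picked absent with pick w
      star-picked {w} {c} refl absent | just c with present? w c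
      ... | yes present = contradiction present absent
      ... | no _        = refl

      open StarExtension (proj₁ (proj₂ rest-colouring)) p-uncoloured {star}
        (proj₁ ∘ proj₁ ∘ pick-just ∘ proj₁ ∘ star-just)
        (λ e e' → pick-injective (proj₁ (star-just e)) (proj₁ (star-just e')))
        (λ e e' → proj₂ (star-just e) (_ , e')) public

      saturated-off-p : ∀ {v c} → v ≢ p → c ∈ ℓ v → ∃[ u ] extend v u ≡ just c
      saturated-off-p {v} {c} v≢p c∈ℓv with Maybe.≡-dec _≟_ (pick v) (just c)
      ... | no unpicked with col′-saturating v c (∈-filter⁺ _ c∈ℓv unpicked)
      ...   | u , e = u , extend-⊇ e
      saturated-off-p {v} {c} v≢p c∈ℓv | yes picked with present? v c
      ... | yes (u , e) = u , extend-⊇ e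
      ... | no absent   = p , trans (extend-at-p v≢p) (star-picked picked absent)

      extend-saturating : IsSaturating ℓ extend
      extend-saturating v c c∈ℓv = case v ≟ᶠ p of λ
        { (yes refl) → contradiction c∈ℓv (backless⇒∉ p-backless (ℓ-short p))
        ; (no v≢p) → saturated-off-p v≢p c∈ℓv }

      extend-above : ∀ {u v c} → extend u v ≡ just c → t ≤ r u
      extend-above e with extend-cases e
      ... | inj₁ old           = <⇒≤ (col′-above old)
      ... | inj₂ (inj₁ refl)   = ≤-reflexive (sym rp≡t)
      ... | inj₂ (inj₂ starred) =
        <⇒≤ (subst (_< _) rp≡t (proj₂ (proj₁ (pick-just (proj₁ (star-just starred))))))

    eliminate : IsSimplicial G o → ∀ {t p} → r p ≡ t → SaturableFrom (suc t) → SaturableFrom t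
    eliminate simplicial rp≡t IH ℓ ℓ-unique ℓ-short =
      extend , extend-proper , extend-saturating , extend-above
      where open Eliminate simplicial rp≡t IH ℓ ℓ-unique ℓ-short

    skip : ∀ {t} → (∀ v → r v ≢ t) → SaturableFrom (suc t) → SaturableFrom t
    skip {t} no-rank-t IH ℓ ℓ-unique ℓ-short =
      let col , proper , saturating , above = IH ℓ ℓ-unique ℓ-short′
      in col , proper , saturating , <⇒≤ ∘ above
      where
      back-step : ∀ {v u} → Back t v u → Back (suc t) v u
      back-step {u = u} (a , t≤ru , ru<rv) = a , ≤∧≢⇒< t≤ru (no-rank-t u ∘ sym) , ru<rv

      ℓ-short′ : ∀ v → length (ℓ v) ≤ deg (suc t) v
      ℓ-short′ v = ≤-trans (ℓ-short v) (deg-mono back-step)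

    beyond : ∀ {t} → (∀ v → r v < t) → SaturableFrom t
    beyond {t} r<t ℓ _ ℓ-short = (λ _ _ → nothing) , proper , saturating , λ ()
      where
      proper : IsProperPartialEdgeColouring G (λ _ _ → nothing)
      proper = (λ _ _ → refl) , (λ _ _ _ ()) , (λ _ _ _ _ ())
      saturating : IsSaturating ℓ (λ _ _ → nothing)
      saturating v c c∈ℓv = contradiction c∈ℓv (backless⇒∉ backless (ℓ-short v))
        where
        backless : ∀ u → ¬ Back t v u
        backless u (_ , t≤ru , _) = <-irrefl refl (<-≤-trans (r<t u) t≤ru)

    step : IsSimplicial G o → ∀ {t} → SaturableFrom (suc t) → SaturableFrom t
    step simplicial {t} IH with any? (λ v → r v ≟ t)
    ... | yes (p , rp≡t) = eliminate simplicial rp≡t IH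
    ... | no no-rank-t   = skip (λ v rv≡t → no-rank-t (v , rv≡t)) IH

    saturableFrom : IsSimplicial G o → ∀ t → SaturableFrom t
    saturableFrom simplicial t = descend b t (m≤m+n b t)
      where
      b : ℕ
      b = proj₁ (bounded r)
      descend : ∀ m t → b ≤ m + t → SaturableFrom t
      descend zero    t b≤t = beyond λ v → <-≤-trans (proj₂ (bounded r) v) b≤t
      descend (suc m) t b≤1+m+t =
        step simplicial (descend m (suc t) (subst (b ≤_) (sym (+-suc m t)) b≤1+m+t))

lemma6p11 : (n : ℕ) (G : Graph n) (o : VertexOrder n) →
    IsSimplicial G o → Saturable G (outdeg G o)
lemma6p11 n G o simplicial ℓ ℓ-unique ℓ-short
  with saturableFrom G o simplicial 0 ℓ ℓ-unique (λ v → ≤-trans (ℓ-short v) (outdeg≤deg G o v))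
... | col , proper , saturating , _ = col , proper , saturating
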